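{- Let $G$ be a digraph on $n$ vertices, let $r \ge 9$, and suppose $\mu(G) \ge 25n/r^2$. Then every vertex of $G$ is contained in a directed cycle of length at most $r$.
   Context: A digraph has a finite vertex set $V_G$ and a set of ordered pairs of vertices (edges), with no loops or parallel edges. For $S,T\subseteq V_G$, $e_G(S,T)$ is the number of edges going from a vertex of $S$ to a vertex of $T$. For a nonempty $S\subseteq V_G$ with $|S|\le |V_G|/2$, the edge expansion is $\mu(S)=\frac{1}{|S|}\min\{e_G(S,V_G\setminus S),\, e_G(V_G\setminus S,S)\}$, and the edge expansion of $G$ is $\mu(G)=\min \mu(S)$ over all nonempty $S\subseteq V_G$ with $|S|\le |V_G|/2$. A directed cycle of length $\ell\ge2$ consists of distinct vertices $v_1,\dots,v_\ell$ with edges $(v_i,v_{i+1})$, $1\le i<\ell$, and $(v_\ell,v_1)$. -}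

module Defs where

open import Data.Nat using (ℕ; zero; suc; _+_; _*_; _≤_)
open import Data.Bool using (Bool; true; false; _∧_; if_then_else_)
open import Data.Fin using (Fin; toℕ)
open import Data.Fin.Subset using (Subset; ∁; ∣_∣; Nonempty)
open import Data.Vec using (lookup)
open import Data.List using (List; map; allFin)
open import Data.Nat.ListAction using (sum)
open import Data.Product using (Σ; ∃; _×_)
open import Function.Definitions using (Injective)
open import Relation.Binary.PropositionalEquality using (_≡_)

record Digraph (n : ℕ) : Set where
  field
    edge      : Fin n → Fin n → Bool
    loopless  : ∀ v → edge v v ≡ false
open Digraph public

eG : ∀ {n} → Digraph n → Subset n → Subset n → ℕ
eG {n} G S T =
  sum (map (λ u → sum (map (λ v →
         if lookup S u ∧ lookup T v ∧ edge G u v then 1 else 0)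
       (allFin n))) (allFin n))

-- μ(S) ≥ a/b  (for b > 0, |S| > 0), written with cleared denominators:
-- min{e(S,Sᶜ), e(Sᶜ,S)} / |S| ≥ a/b  ⇔  both  b·e(S,Sᶜ) ≥ a·|S|  and  b·e(Sᶜ,S) ≥ a·|S|.
μS≥ : ∀ {n} → Digraph n → Subset n → (a b : ℕ) → Set
μS≥ G S a b = (a * ∣ S ∣ ≤ b * eG G S (∁ S)) × (a * ∣ S ∣ ≤ b * eG G (∁ S) S)

μG≥ : ∀ {n} → Digraph n → (a b : ℕ) → Set
μG≥ {n} G a b = (S : Subset n) → Nonempty S → 2 * ∣ S ∣ ≤ n → μS≥ G S a b

record DirectedCycle {n : ℕ} (G : Digraph n) (ℓ : ℕ) : Set where
  field
    len≥2    : 2 ≤ ℓ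
    vert     : Fin ℓ → Fin n
    distinct : Injective _≡_ _≡_ vert
    step     : ∀ (i j : Fin ℓ) → toℕ j ≡ suc (toℕ i) → edge G (vert i) (vert j) ≡ true
    close    : ∀ (i j : Fin ℓ) → suc (toℕ i) ≡ ℓ → toℕ j ≡ 0 → edge G (vert i) (vert j) ≡ true
open DirectedCycle public

OnShortCycle : ∀ {n} → Digraph n → ℕ → Fin n → Set
OnShortCycle G r v =
  Σ ℕ λ ℓ → (ℓ ≤ r) × Σ (DirectedCycle G ℓ) λ C → ∃ λ i → vert C i ≡ v

-- Let Bₖ be the set of vertices reachable from v by a walk of length at most k. Every edge
-- leaving Bₖ runs from the sphere Sₖ = Bₖ ∖ Bₖ₋₁ to Sₖ₊₁, so while |Bₖ| ≤ n/2 the expansion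
-- hypothesis gives (25n/r²)|Bₖ| ≤ |Sₖ||Sₖ₊₁|. With AM-GM and |Bₖ₊₁| = |Bₖ₋₁| + |Sₖ| + |Sₖ₊₁|
-- this yields |Bₖ| ≥ 25nk²/(4r²) by induction, so for k = ⌊r/2⌋ - 1 the ball holds more than
-- half of the vertices, and one more step, by expansion of its complement, at least n/2 + 1.
-- The same holds for the vertices from which v is reachable, so the two balls of radius
-- ⌊r/2⌋ share a vertex w ≠ v. Walking back from w yields an out-neighbour y of v from which v
-- is reachable in at most 2⌊r/2⌋ - 1 steps, and a shortest path from y to v closes a directed
-- cycle through v of length at most r.

module Submission where

open import Defs
open import Data.Bool using (Bool; true; false; _∧_; _∨_; not; if_then_else_)
open import Data.Bool.Properties using (not-involutive; not-injective; ∧-comm; ∧-assoc)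
open import Data.Fin using (Fin; zero; suc; toℕ; fromℕ)
open import Data.Fin.Properties using (_≟_; toℕ-fromℕ; nonZeroIndex)
open import Data.Fin.Subset using (∁; ∣_∣)
import Data.List as List using (map; allFin; tabulate)
open import Data.List.Properties using (map-tabulate)
import Data.Nat.ListAction as List
open import Data.Nat using (ℕ; zero; suc; _+_; _*_; _≤_; _<_; z≤n; s≤s; >-nonZero; >-nonZero⁻¹)
open import Data.Nat.Properties hiding (_≟_)
open import Data.Nat.Tactic.RingSolver using (solve-∀)
open import Algebra.Properties.Semiring.Sum +-*-semiring
  using (sum; sum-cong-≗; sum-replicate-zero; ∑-distrib-+; ∑-comm; *-distribˡ-sum; *-distribʳ-sum)
open import Data.Product using (Σ; ∃; _×_; _,_; proj₁; proj₂)
open import Data.Sum using (_⊎_; inj₁; inj₂)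
open import Data.Vec using (tabulate)
open import Data.Vec.Properties using (lookup∘tabulate; lookup⇒[]=; tabulate-∘)
open import Function using (_∘_; id; flip; case_of_)
open import Function.Definitions using (Injective)
open import Relation.Nullary using (does; yes; no; contradiction)
open import Relation.Nullary.Decidable using (dec-true)
open import Relation.Binary.PropositionalEquality

∧-true⁻ : ∀ {a b} → a ∧ b ≡ true → a ≡ true × b ≡ true
∧-true⁻ {true} b≡true = refl , b≡true

any : ∀ {n} → (Fin n → Bool) → Bool
any {zero}  P = false
any {suc n} P = P zero ∨ any (P ∘ suc)

any-true⁺ : ∀ {n} (P : Fin n → Bool) {x} → P x ≡ true → any P ≡ true
any-true⁺ P {zero}  Px rewrite Px = refl
any-true⁺ P {suc x} Px with P zero
... | true  = refl
... | false = any-true⁺ (P ∘ suc) Px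

any-true⁻ : ∀ {n} (P : Fin n → Bool) → any P ≡ true → ∃ λ x → P x ≡ true
any-true⁻ {suc n} P anyP with P zero in P0
... | true  = zero , P0
... | false = let x , Px = any-true⁻ (P ∘ suc) anyP in suc x , Px

∨-true⁻ : ∀ a {b} → a ∨ b ≡ true → a ≡ true ⊎ b ≡ true
∨-true⁻ true  _ = inj₁ refl
∨-true⁻ false b = inj₂ b

true-or-false : ∀ b → b ≡ true ⊎ b ≡ false
true-or-false true  = inj₁ refl
true-or-false false = inj₂ refl

-- Finite sums and counting

∑-mono-≤ : ∀ {n} {f g : Fin n → ℕ} → (∀ i → f i ≤ g i) → sum f ≤ sum g
∑-mono-≤ {zero}  f≤g = z≤n
∑-mono-≤ {suc n} f≤g = +-mono-≤ (f≤g zero) (∑-mono-≤ (f≤g ∘ suc))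

∑-const-1 : ∀ n → sum {n} (λ _ → 1) ≡ n
∑-const-1 zero    = refl
∑-const-1 (suc n) = cong suc (∑-const-1 n)

∑∑-product : ∀ {n} (f g : Fin n → ℕ) →
             sum (λ x → sum (λ y → f x * g y)) ≡ sum f * sum g
∑∑-product f g = begin
  sum (λ x → sum (λ y → f x * g y)) ≡⟨ sum-cong-≗ (λ x → sym (*-distribˡ-sum (f x) g)) ⟩
  sum (λ x → f x * sum g)           ≡⟨ sym (*-distribʳ-sum (sum g) f) ⟩
  sum f * sum g                     ∎
  where open ≡-Reasoning

sum-map-allFin : ∀ {n} (f : Fin n → ℕ) → List.sum (List.map f (List.allFin n)) ≡ sum f
sum-map-allFin {n} f = trans (cong List.sum (map-tabulate {n = n} id f)) (sum-tabulate f)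
  where
  sum-tabulate : ∀ {m} (g : Fin m → ℕ) → List.sum (List.tabulate g) ≡ sum g
  sum-tabulate {zero}  g = refl
  sum-tabulate {suc m} g = cong (g zero +_) (sum-tabulate (g ∘ suc))

χ : Bool → ℕ
χ b = if b then 1 else 0

count : ∀ {n} → (Fin n → Bool) → ℕ
count P = sum (χ ∘ P)

χ≤χ*χ : ∀ {a b c} → (a ≡ true → b ≡ true × c ≡ true) → χ a ≤ χ b * χ c
χ≤χ*χ {false} _ = z≤n
χ≤χ*χ {true}  a⇒b×c with a⇒b×c refl
... | refl , refl = ≤-refl

∑-pointwise-≤ : ∀ {n} {f g h : Fin n → ℕ} → (∀ i → f i + g i ≤ h i) →
                sum f + sum g ≤ sum h
∑-pointwise-≤ {f = f} {g} f+g≤h =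
  ≤-trans (≤-reflexive (sym (∑-distrib-+ f g))) (∑-mono-≤ f+g≤h)

count-∁ : ∀ {n} (P : Fin n → Bool) → count (not ∘ P) + count P ≡ n
count-∁ {n} P = begin
  count (not ∘ P) + count P       ≡⟨ sym (∑-distrib-+ (χ ∘ not ∘ P) (χ ∘ P)) ⟩
  sum (λ x → χ (not (P x)) + χ (P x)) ≡⟨ sum-cong-≗ (λ x → χ-not (P x)) ⟩
  sum {n} (λ _ → 1)               ≡⟨ ∑-const-1 n ⟩
  n                               ∎
  where
  open ≡-Reasoning
  χ-not : ∀ b → χ (not b) + χ b ≡ 1
  χ-not true  = refl
  χ-not false = refl

count>0⇒∃ : ∀ {n} (P : Fin n → Bool) → 1 ≤ count P → ∃ λ x → P x ≡ true
count>0⇒∃ {suc n} P 1≤count with P zero in P0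
... | true  = zero , P0
... | false = let x , Px = count>0⇒∃ (P ∘ suc) 1≤count in suc x , Px

∃⇒count>0 : ∀ {n} (P : Fin n → Bool) {x} → P x ≡ true → 1 ≤ count P
∃⇒count>0 P {zero}  Px rewrite Px = s≤s z≤n
∃⇒count>0 P {suc x} Px = ≤-trans (∃⇒count>0 (P ∘ suc) Px) (m≤n+m _ _)

count-∧ : ∀ {n} (P Q : Fin n → Bool) → count P + count Q ≤ n + count (λ x → P x ∧ Q x)
count-∧ {n} P Q = begin
  count P + count Q           ≤⟨ ∑-pointwise-≤ (λ x → χ-∧ (P x) (Q x)) ⟩
  sum (λ x → 1 + χ (P∧Q x))   ≡⟨ ∑-distrib-+ (λ _ → 1) (χ ∘ P∧Q) ⟩
  sum {n} (λ _ → 1) + count P∧Q ≡⟨ cong (_+ count P∧Q) (∑-const-1 n) ⟩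
  n + count P∧Q               ∎
  where
  open ≤-Reasoning
  P∧Q : Fin n → Bool
  P∧Q x = P x ∧ Q x
  χ-∧ : ∀ a b → χ a + χ b ≤ 1 + χ (a ∧ b)
  χ-∧ true  true  = ≤-refl
  χ-∧ true  false = ≤-refl
  χ-∧ false true  = ≤-refl
  χ-∧ false false = z≤n

count-singleton : ∀ {n} (v : Fin n) → count (λ x → does (x ≟ v)) ≡ 1
count-singleton {suc n} zero    = cong suc (sum-replicate-zero n)
count-singleton {suc n} (suc v) = count-singleton v

common-element : ∀ {n} (P Q : Fin n → Bool) (v : Fin n) → n + 2 ≤ count P + count Q →
                 ∃ λ w → P w ≡ true × Q w ≡ true × w ≢ v
common-element {n} P Q v n+2≤ = witness (count>0⇒∃ S 1≤S)
  where
  is-v R S : Fin n → Bool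
  is-v x = does (x ≟ v)
  R x = P x ∧ Q x
  S x = R x ∧ not (is-v x)

  split : ∀ b c → χ b ≤ χ c + χ (b ∧ not c)
  split true  true  = ≤-refl
  split true  false = ≤-refl
  split false c     = z≤n

  2≤R : 2 ≤ count R
  2≤R = +-cancelˡ-≤ n 2 (count R) (≤-trans n+2≤ (count-∧ P Q))

  1≤S : 1 ≤ count S
  1≤S = +-cancelˡ-≤ 1 1 (count S) (begin
    2                                        ≤⟨ 2≤R ⟩
    count R                          ≤⟨ ∑-mono-≤ (λ x → split (R x) (is-v x)) ⟩
    sum (λ x → χ (is-v x) + χ (S x)) ≡⟨ ∑-distrib-+ (χ ∘ is-v) (χ ∘ S) ⟩
    count is-v + count S             ≡⟨ cong (_+ count S) (count-singleton v) ⟩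
    1 + count S                      ∎)
    where open ≤-Reasoning

  witness : (∃ λ w → S w ≡ true) → ∃ λ w → P w ≡ true × Q w ≡ true × w ≢ v
  witness (w , Sw) =
    let Rw , w≉v = ∧-true⁻ Sw ; Pw , Qw = ∧-true⁻ Rw
    in w , Pw , Qw , λ w≡v → case trans (cong not (sym (dec-true (w ≟ v) w≡v))) w≉v of λ ()

-- Edge expansion

edges : ∀ {n} → (Fin n → Fin n → Bool) → (Fin n → Bool) → (Fin n → Bool) → ℕ
edges E P Q = sum λ x → sum λ y → χ (P x ∧ Q y ∧ E x y)

edges-flip : ∀ {n} (E : Fin n → Fin n → Bool) (P Q : Fin n → Bool) →
             edges (flip E) P Q ≡ edges E Q P
edges-flip E P Q = trans (∑-comm (λ x y → χ (P x ∧ Q y ∧ E y x)))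
  (sum-cong-≗ λ y → sum-cong-≗ λ x → cong χ (∧-swap (P x) (Q y) (E y x)))
  where
  ∧-swap : ∀ a b c → a ∧ b ∧ c ≡ b ∧ a ∧ c
  ∧-swap a b c = trans (sym (∧-assoc a b c)) (trans (cong (_∧ c) (∧-comm a b)) (∧-assoc b a c))

edges-cong : ∀ {n} (E : Fin n → Fin n → Bool) {P P′ Q : Fin n → Bool} →
             (∀ x → P x ≡ P′ x) → edges E P Q ≡ edges E P′ Q
edges-cong E {Q = Q} P≗P′ =
  sum-cong-≗ λ x → sum-cong-≗ λ y → cong (λ b → χ (b ∧ Q y ∧ E x y)) (P≗P′ x)

∣tabulate∣≡count : ∀ {n} (P : Fin n → Bool) → ∣ tabulate P ∣ ≡ count P
∣tabulate∣≡count {zero}  P = refl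
∣tabulate∣≡count {suc n} P with P zero
... | true  = cong suc (∣tabulate∣≡count (P ∘ suc))
... | false = ∣tabulate∣≡count (P ∘ suc)

eG-tabulate : ∀ {n} (G : Digraph n) (P Q : Fin n → Bool) →
              eG G (tabulate P) (tabulate Q) ≡ edges (edge G) P Q
eG-tabulate {n} G P Q =
  trans (sum-map-allFin {n} _) (sum-cong-≗ λ x → trans (sum-map-allFin {n} _) (sum-cong-≗ λ y →
    cong₂ (λ a b → χ (a ∧ b ∧ edge G x y)) (lookup∘tabulate P x) (lookup∘tabulate Q y)))

record Expanding {n : ℕ} (E : Fin n → Fin n → Bool) (c R : ℕ) : Set where
  field
    out-expansion : ∀ S → 1 ≤ count S → 2 * count S ≤ n →
                    c * count S ≤ R * edges E S (not ∘ S)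
    in-expansion  : ∀ S → 1 ≤ count S → 2 * count S ≤ n →
                    c * count S ≤ R * edges E (not ∘ S) S

open Expanding

μG≥⇒Expanding : ∀ {n} (G : Digraph n) (c R : ℕ) → μG≥ G c R → Expanding (edge G) c R
μG≥⇒Expanding {n} G c R μ≥ = record
  { out-expansion = λ S 1≤|S| 2|S|≤n →
      subst₂ (λ k e → c * k ≤ R * e) (∣tabulate∣≡count S) (out-edges S)
        (proj₁ (μS S 1≤|S| 2|S|≤n))
  ; in-expansion  = λ S 1≤|S| 2|S|≤n →
      subst₂ (λ k e → c * k ≤ R * e) (∣tabulate∣≡count S) (in-edges S)
        (proj₂ (μS S 1≤|S| 2|S|≤n))
  }
  where
  μS : ∀ S → 1 ≤ count S → 2 * count S ≤ n → μS≥ G (tabulate S) c R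
  μS S 1≤|S| 2|S|≤n =
    let x , Sx = count>0⇒∃ S 1≤|S|
    in μ≥ (tabulate S) (x , lookup⇒[]= x (tabulate S) (trans (lookup∘tabulate S x) Sx))
          (subst (λ k → 2 * k ≤ n) (sym (∣tabulate∣≡count S)) 2|S|≤n)

  ∁-tabulate : ∀ S → ∁ (tabulate S) ≡ tabulate (not ∘ S)
  ∁-tabulate S = sym (tabulate-∘ not S)

  out-edges : ∀ S → eG G (tabulate S) (∁ (tabulate S)) ≡ edges (edge G) S (not ∘ S)
  out-edges S = trans (cong (eG G (tabulate S)) (∁-tabulate S)) (eG-tabulate G S (not ∘ S))

  in-edges : ∀ S → eG G (∁ (tabulate S)) (tabulate S) ≡ edges (edge G) (not ∘ S) S
  in-edges S = trans (cong (λ T → eG G T (tabulate S)) (∁-tabulate S)) (eG-tabulate G (not ∘ S) S)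

Expanding-flip : ∀ {n} {E : Fin n → Fin n → Bool} {c R : ℕ} →
                 Expanding E c R → Expanding (flip E) c R
Expanding-flip {E = E} {c} {R} exp = record
  { out-expansion = λ S 1≤|S| 2|S|≤n → subst (λ e → c * count S ≤ R * e)
      (sym (edges-flip E S (not ∘ S))) (in-expansion exp S 1≤|S| 2|S|≤n)
  ; in-expansion  = λ S 1≤|S| 2|S|≤n → subst (λ e → c * count S ≤ R * e)
      (sym (edges-flip E (not ∘ S) S)) (out-expansion exp S 1≤|S| 2|S|≤n)
  }

1≤m*n⇒1≤n : ∀ m {n} → 1 ≤ m * n → 1 ≤ n
1≤m*n⇒1≤n m {n} 1≤mn = >-nonZero⁻¹ n {{m*n≢0⇒n≢0 m {{>-nonZero 1≤mn}}}}

complement-small : ∀ {a b n} → a + b ≡ n → n < 2 * b → 2 * a ≤ n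
complement-small {a} {b} {n} a+b≡n n<2b = +-cancelʳ-≤ (2 * b) (2 * a) n (begin
  2 * a + 2 * b ≡⟨ sym (*-distribˡ-+ 2 a b) ⟩
  2 * (a + b)   ≡⟨ cong (2 *_) a+b≡n ⟩
  2 * n         ≡⟨ cong (n +_) (+-identityʳ n) ⟩
  n + n         ≤⟨ +-monoʳ-≤ n (<⇒≤ n<2b) ⟩
  n + 2 * b     ∎)
  where open ≤-Reasoning

Expanding⇒edge-leaves : ∀ {n} {E : Fin n → Fin n → Bool} {c R : ℕ} →
  Expanding E c R → 1 ≤ c → (S : Fin n → Bool) →
  1 ≤ count S → 1 ≤ count (not ∘ S) → 1 ≤ edges E S (not ∘ S)
Expanding⇒edge-leaves {n} {E} {c} {R} exp 1≤c S 1≤|S| 1≤|∁S| =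
  let k , 1≤k , ck≤Re = expanding-side in 1≤m*n⇒1≤n R (≤-trans (*-mono-≤ 1≤c 1≤k) ck≤Re)
  where
  expanding-side : ∃ λ k → 1 ≤ k × c * k ≤ R * edges E S (not ∘ S)
  expanding-side with 2 * count S ≤? n
  ... | yes 2|S|≤n = count S , 1≤|S| , out-expansion exp S 1≤|S| 2|S|≤n
  ... | no  2|S|≰n = count (not ∘ S) , 1≤|∁S| ,
    subst (λ e → c * count (not ∘ S) ≤ R * e) (edges-cong E (not-involutive ∘ S))
      (in-expansion exp (not ∘ S) 1≤|∁S|
        (complement-small {count (not ∘ S)} (count-∁ S) (≰⇒> 2|S|≰n)))

-- Balls and spheres

-- Applied to flip E, ball k consists of the vertices from which v is reachable in at most
-- k steps.
module Ball {n : ℕ} (E : Fin n → Fin n → Bool) (v : Fin n) where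

  ball : ℕ → Fin n → Bool
  ball zero    w = does (w ≟ v)
  ball (suc k) w = ball k w ∨ any (λ x → ball k x ∧ E x w)

  sphere : ℕ → Fin n → Bool
  sphere zero      = ball zero
  sphere (suc k) w = ball (suc k) w ∧ not (ball k w)

  ball-centre : ∀ k → ball k v ≡ true
  ball-centre zero    = dec-true (v ≟ v) refl
  ball-centre (suc k) rewrite ball-centre k = refl

  1≤count-ball : ∀ k → 1 ≤ count (ball k)
  1≤count-ball k = ∃⇒count>0 (ball k) {v} (ball-centre k)

  ball-zero⁻ : ∀ {w} → ball 0 w ≡ true → w ≡ v
  ball-zero⁻ {w} w∈B₀ with w ≟ v
  ... | yes w≡v = w≡v

  ball-suc⁺ : ∀ k {w} → ball k w ≡ true → ball (suc k) w ≡ true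
  ball-suc⁺ k w∈Bₖ rewrite w∈Bₖ = refl

  ball-mono : ∀ {k j w} → k ≤ j → ball k w ≡ true → ball j w ≡ true
  ball-mono {k} {j} {w} k≤j w∈Bₖ with m≤n⇒∃[o]m+o≡n k≤j
  ... | o , refl = grow o
    where
    grow : ∀ o → ball (k + o) w ≡ true
    grow zero    rewrite +-identityʳ k = w∈Bₖ
    grow (suc o) rewrite +-suc k o = ball-suc⁺ (k + o) (grow o)

  ball-step : ∀ k {x w} → ball k x ≡ true → E x w ≡ true → ball (suc k) w ≡ true
  ball-step k {x} {w} x∈Bₖ Exw with ball k w
  ... | true  = refl
  ... | false = any-true⁺ (λ y → ball k y ∧ E y w) (cong₂ _∧_ x∈Bₖ Exw)

  ball-suc⁻ : ∀ k {w} → ball (suc k) w ≡ true →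
              ball k w ≡ true ⊎ ∃ λ x → ball k x ≡ true × E x w ≡ true
  ball-suc⁻ k {w} w∈Bₖ₊₁ with ∨-true⁻ (ball k w) w∈Bₖ₊₁
  ... | inj₁ w∈Bₖ = inj₁ w∈Bₖ
  ... | inj₂ ∃x  = let x , x∈Bₖ∧Exw = any-true⁻ (λ y → ball k y ∧ E y w) ∃x
                   in inj₂ (x , ∧-true⁻ x∈Bₖ∧Exw)

  sphere⇒ball : ∀ k {w} → sphere k w ≡ true → ball k w ≡ true
  sphere⇒ball zero    w∈S₀ = w∈S₀
  sphere⇒ball (suc k) w∈Sₖ₊₁ = proj₁ (∧-true⁻ w∈Sₖ₊₁)

  sphere-suc⁺ : ∀ k {w} → ball (suc k) w ≡ true → ball k w ≡ false → sphere (suc k) w ≡ true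
  sphere-suc⁺ k w∈Bₖ₊₁ w∉Bₖ =
    subst₂ (λ a b → a ∧ not b ≡ true) (sym w∈Bₖ₊₁) (sym w∉Bₖ) refl

  sphere-suc⁻ : ∀ k {w} → sphere (suc k) w ≡ true → ball k w ≡ false
  sphere-suc⁻ k {w} w∈Sₖ₊₁ with ball k w | proj₂ (∧-true⁻ {ball (suc k) w} w∈Sₖ₊₁)
  ... | false | _ = refl

  ball-suc-split : ∀ k {w} → ball (suc k) w ≡ true → ball k w ≡ true ⊎ sphere (suc k) w ≡ true
  ball-suc-split k {w} w∈Bₖ₊₁ with true-or-false (ball k w)
  ... | inj₁ w∈Bₖ = inj₁ w∈Bₖ
  ... | inj₂ w∉Bₖ = inj₂ (sphere-suc⁺ k w∈Bₖ₊₁ w∉Bₖ)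

  ball⇒sphere : ∀ k {w} → ball k w ≡ true → ∃ λ d → d ≤ k × sphere d w ≡ true
  ball⇒sphere zero    w∈B₀ = 0 , z≤n , w∈B₀
  ball⇒sphere (suc k) w∈Bₖ₊₁ with ball-suc-split k w∈Bₖ₊₁
  ... | inj₁ w∈Bₖ   = let d , d≤k , w∈S = ball⇒sphere k w∈Bₖ
                      in d , m≤n⇒m≤1+n d≤k , w∈S
  ... | inj₂ w∈Sₖ₊₁ = suc k , ≤-refl , w∈Sₖ₊₁

  boundary : ∀ k {x y} → ball k x ≡ true → ball k y ≡ false → E x y ≡ true →
             sphere k x ≡ true × sphere (suc k) y ≡ true
  boundary zero    x∈B₀ y∉B₀ Exy = x∈B₀ , sphere-suc⁺ 0 (ball-step 0 x∈B₀ Exy) y∉B₀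
  boundary (suc j) x∈Bⱼ₊₁ y∉Bⱼ₊₁ Exy with ball-suc-split j x∈Bⱼ₊₁
  ... | inj₂ x∈Sⱼ₊₁ =
    x∈Sⱼ₊₁ , sphere-suc⁺ (suc j) (ball-step (suc j) x∈Bⱼ₊₁ Exy) y∉Bⱼ₊₁
  ... | inj₁ x∈Bⱼ   = case trans (sym (ball-step j x∈Bⱼ Exy)) y∉Bⱼ₊₁ of λ ()

  sphere-pred : ∀ k {w} → sphere (suc k) w ≡ true → ∃ λ x → sphere k x ≡ true × E x w ≡ true
  sphere-pred k {w} w∈Sₖ₊₁ with ball-suc⁻ k (sphere⇒ball (suc k) w∈Sₖ₊₁)
  ... | inj₁ w∈Bₖ = case trans (sym w∈Bₖ) (sphere-suc⁻ k w∈Sₖ₊₁) of λ ()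
  ... | inj₂ (x , x∈Bₖ , Exw) =
    x , proj₁ (boundary k x∈Bₖ (sphere-suc⁻ k w∈Sₖ₊₁) Exw) , Exw

  count-ball-suc : ∀ k → count (ball (suc k)) ≡ count (ball k) + count (sphere (suc k))
  count-ball-suc k = trans (sum-cong-≗ split) (∑-distrib-+ (χ ∘ ball k) (χ ∘ sphere (suc k)))
    where
    split : ∀ w → χ (ball (suc k) w) ≡ χ (ball k w) + χ (sphere (suc k) w)
    split w with ball k w | any (λ x → ball k x ∧ E x w)
    ... | true  | _     = refl
    ... | false | true  = refl
    ... | false | false = refl

  edges-leaving-ball : ∀ k →
    edges E (ball k) (not ∘ ball k) ≤ count (sphere k) * count (sphere (suc k))
  edges-leaving-ball k = ≤-trans (∑-mono-≤ λ x → ∑-mono-≤ λ y → χ≤χ*χ (crossing x y))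
                                 (≤-reflexive (∑∑-product (χ ∘ sphere k) (χ ∘ sphere (suc k))))
    where
    crossing : ∀ x y → ball k x ∧ not (ball k y) ∧ E x y ≡ true →
               sphere k x ≡ true × sphere (suc k) y ≡ true
    crossing x y h = let x∈Bₖ , rest = ∧-true⁻ h ; y∉Bₖ , Exy = ∧-true⁻ rest
                     in boundary k x∈Bₖ (not-injective y∉Bₖ) Exy

-- Growth of balls

m*m≤n*n⇒m≤n : ∀ {m n} → m * m ≤ n * n → m ≤ n
m*m≤n*n⇒m≤n {m} {n} m²≤n² with m ≤? n
... | yes m≤n = m≤n
... | no  m≰n = contradiction m²≤n² (<⇒≱ (*-mono-< (≰⇒> m≰n) (≰⇒> m≰n)))

4mn≤[m+n]² : ∀ m n → 4 * (m * n) ≤ (m + n) * (m + n)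
4mn≤[m+n]² m n with ≤-total m n
... | inj₁ m≤n = let d , m+d≡n = m≤n⇒∃[o]m+o≡n m≤n in
  subst (λ n → 4 * (m * n) ≤ (m + n) * (m + n)) m+d≡n
    (≤-trans (m≤m+n _ (d * d)) (≤-reflexive (sq m d)))
  where
  sq : ∀ m d → 4 * (m * (m + d)) + d * d ≡ (m + (m + d)) * (m + (m + d))
  sq = solve-∀
... | inj₂ n≤m = let d , n+d≡m = m≤n⇒∃[o]m+o≡n n≤m in
  subst (λ m → 4 * (m * n) ≤ (m + n) * (m + n)) n+d≡m
    (≤-trans (m≤m+n _ (d * d)) (≤-reflexive (sq n d)))
  where
  sq : ∀ n d → 4 * ((n + d) * n) + d * d ≡ (n + d + n) * (n + d + n)
  sq = solve-∀

linear-from-quadratic : ∀ c R K b x y → c * (K * K) ≤ 4 * R * b → c * b ≤ R * (x * y) →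
                        c * K ≤ R * (x + y)
linear-from-quadratic c R K b x y cK²≤4Rb cb≤Rxy = m*m≤n*n⇒m≤n (begin
  (c * K) * (c * K)       ≡⟨ e₁ c K ⟩
  c * (c * (K * K))       ≤⟨ *-monoʳ-≤ c cK²≤4Rb ⟩
  c * (4 * R * b)         ≡⟨ e₂ c R b ⟩
  4 * R * (c * b)         ≤⟨ *-monoʳ-≤ (4 * R) cb≤Rxy ⟩
  4 * R * (R * (x * y))   ≡⟨ e₃ R x y ⟩
  R * R * (4 * (x * y))   ≤⟨ *-monoʳ-≤ (R * R) (4mn≤[m+n]² x y) ⟩
  R * R * ((x + y) * (x + y)) ≡⟨ e₄ R (x + y) ⟩
  R * (x + y) * (R * (x + y)) ∎)
  where
  open ≤-Reasoning
  e₁ : ∀ c K → (c * K) * (c * K) ≡ c * (c * (K * K))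
  e₁ = solve-∀
  e₂ : ∀ c R b → c * (4 * R * b) ≡ 4 * R * (c * b)
  e₂ = solve-∀
  e₃ : ∀ R x y → 4 * R * (R * (x * y)) ≡ R * R * (4 * (x * y))
  e₃ = solve-∀
  e₄ : ∀ R z → R * R * (z * z) ≡ R * z * (R * z)
  e₄ = solve-∀

-- b and l stand for the sizes of the balls and spheres around a vertex.
module QuadraticGrowth (n c R : ℕ) (b l : ℕ → ℕ) (1≤b₀ : 1 ≤ b 0) (l₀≡b₀ : l 0 ≡ b 0)
  (b-suc : ∀ k → b (suc k) ≡ b k + l (suc k))
  (expansion : ∀ k → 2 * b k ≤ n → c * b k ≤ R * (l k * l (suc k))) where

  at-most-half-pred : ∀ k → 2 * b (suc k) ≤ n → 2 * b k ≤ n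
  at-most-half-pred k 2bₖ₊₁≤n =
    ≤-trans (*-monoʳ-≤ 2 (subst (b k ≤_) (sym (b-suc k)) (m≤m+n _ _))) 2bₖ₊₁≤n

  growth-base : 2 * b 1 ≤ n → c * 1 ≤ 4 * R * b 1
  growth-base 2b₁≤n = begin
    c * 1             ≡⟨ *-identityʳ c ⟩
    c                 ≤⟨ c≤Rl₁ ⟩
    R * l 1           ≤⟨ *-monoʳ-≤ R (subst (l 1 ≤_) (sym (b-suc 0)) (m≤n+m _ _)) ⟩
    R * b 1           ≤⟨ m≤n*m (R * b 1) 4 ⟩
    4 * (R * b 1)     ≡⟨ sym (*-assoc 4 R (b 1)) ⟩
    4 * R * b 1       ∎
    where
    open ≤-Reasoning
    e : ∀ R x y → R * (x * y) ≡ R * y * x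
    e = solve-∀
    c≤Rl₁ : c ≤ R * l 1
    c≤Rl₁ = *-cancelʳ-≤ c (R * l 1) (b 0) {{>-nonZero 1≤b₀}} (begin
      c * b 0               ≤⟨ expansion 0 (at-most-half-pred 0 2b₁≤n) ⟩
      R * (l 0 * l 1)       ≡⟨ cong (λ z → R * (z * l 1)) l₀≡b₀ ⟩
      R * (b 0 * l 1)       ≡⟨ e R (b 0) (l 1) ⟩
      R * l 1 * b 0         ∎)

  growth-step : ∀ k → 2 * b (2 + k) ≤ n → c * (k * k) ≤ 4 * R * b k →
                c * ((1 + k) * (1 + k)) ≤ 4 * R * b (1 + k) →
                c * ((2 + k) * (2 + k)) ≤ 4 * R * b (2 + k)
  growth-step k 2bₖ₊₂≤n ck²≤ c[k+1]²≤ = begin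
    c * ((2 + k) * (2 + k))           ≡⟨ e₁ c k ⟩
    c * (k * k) + 4 * (c * (1 + k))   ≤⟨ +-mono-≤ ck²≤ (*-monoʳ-≤ 4 linear) ⟩
    4 * R * b k + 4 * (R * (l (1 + k) + l (2 + k))) ≡⟨ e₂ R (b k) (l (1 + k)) (l (2 + k)) ⟩
    4 * R * (b k + l (1 + k) + l (2 + k)) ≡⟨ cong (λ z → 4 * R * (z + l (2 + k))) (sym (b-suc k)) ⟩
    4 * R * (b (1 + k) + l (2 + k))   ≡⟨ cong (4 * R *_) (sym (b-suc (suc k))) ⟩
    4 * R * b (2 + k)                 ∎
    where
    open ≤-Reasoning
    linear : c * (1 + k) ≤ R * (l (1 + k) + l (2 + k))
    linear = linear-from-quadratic c R (1 + k) (b (1 + k)) (l (1 + k)) (l (2 + k))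
               c[k+1]²≤ (expansion (suc k) (at-most-half-pred (suc k) 2bₖ₊₂≤n))
    e₁ : ∀ c k → c * ((2 + k) * (2 + k)) ≡ c * (k * k) + 4 * (c * (1 + k))
    e₁ = solve-∀
    e₂ : ∀ R b x y → 4 * R * b + 4 * (R * (x + y)) ≡ 4 * R * (b + x + y)
    e₂ = solve-∀

  quadratic-growth : ∀ k → 2 * b k ≤ n → c * (k * k) ≤ 4 * R * b k
  quadratic-growth zero          _       = subst (_≤ 4 * R * b 0) (sym (*-zeroʳ c)) z≤n
  quadratic-growth (suc zero)    2b₁≤n   = growth-base 2b₁≤n
  quadratic-growth (suc (suc k)) 2bₖ₊₂≤n = growth-step k 2bₖ₊₂≤n
    (quadratic-growth k (at-most-half-pred k (at-most-half-pred (suc k) 2bₖ₊₂≤n)))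
    (quadratic-growth (suc k) (at-most-half-pred (suc k) 2bₖ₊₂≤n))

module ExpandingBall {n : ℕ} {E : Fin n → Fin n → Bool} {a R : ℕ} (exp : Expanding E (a * n) R)
                     (v : Fin n) where
  open Ball E v

  open QuadraticGrowth n (a * n) R (λ k → count (ball k)) (λ k → count (sphere k))
    (1≤count-ball 0) refl count-ball-suc
    (λ k 2bₖ≤n → ≤-trans (out-expansion exp (ball k) (1≤count-ball k) 2bₖ≤n)
                          (*-monoʳ-≤ R (edges-leaving-ball k)))
    using (quadratic-growth)

  ball-more-than-half : ∀ k → 2 * R < a * (k * k) → n < 2 * count (ball k)
  ball-more-than-half k 2R<ak² with n <? 2 * count (ball k)
  ... | yes n<2bₖ = n<2bₖ
  ... | no  n≮2bₖ = contradiction 2R<ak² (≤⇒≯ (*-cancelˡ-≤ n {{nonZeroIndex v}} (begin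
    n * (a * (k * k))             ≡⟨ e₁ n a k ⟩
    a * n * (k * k)               ≤⟨ quadratic-growth k 2bₖ≤n ⟩
    4 * R * count (ball k)        ≡⟨ e₂ R (count (ball k)) ⟩
    2 * R * (2 * count (ball k))  ≤⟨ *-monoʳ-≤ (2 * R) 2bₖ≤n ⟩
    2 * R * n                     ≡⟨ *-comm (2 * R) n ⟩
    n * (2 * R)                   ∎)))
    where
    open ≤-Reasoning
    2bₖ≤n : 2 * count (ball k) ≤ n
    2bₖ≤n = ≮⇒≥ n≮2bₖ
    e₁ : ∀ n a k → n * (a * (k * k)) ≡ a * n * (k * k)
    e₁ = solve-∀
    e₂ : ∀ R b → 4 * R * b ≡ 2 * R * (2 * b)
    e₂ = solve-∀

  ball-grows-or-full : 1 ≤ a → ∀ k → count (ball k) ≡ n ⊎ 1 ≤ count (sphere (suc k))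
  ball-grows-or-full 1≤a k with count (not ∘ ball k) in |∁Bₖ|
  ... | zero  = inj₁ (trans (sym (cong (_+ count (ball k)) |∁Bₖ|)) (count-∁ (ball k)))
  ... | suc _ = inj₂ (1≤m*n⇒1≤n (count (sphere k)) (≤-trans
          (Expanding⇒edge-leaves exp 1≤an (ball k) (1≤count-ball k)
            (subst (1 ≤_) (sym |∁Bₖ|) (s≤s z≤n)))
          (edges-leaving-ball k)))
    where
    1≤an : 1 ≤ a * n
    1≤an = *-mono-≤ 1≤a (>-nonZero⁻¹ n {{nonZeroIndex v}})

  ball-beyond-half : 1 ≤ a → 2 ≤ n → ∀ k → 2 * R < a * (k * k) →
                     n + 2 ≤ 2 * count (ball (suc k))
  ball-beyond-half 1≤a 2≤n k 2R<ak² = begin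
    n + 2                 ≤⟨ n+2≤2bₖ+2sₖ₊₁ (ball-grows-or-full 1≤a k) ⟩
    2 * bₖ + 2 * sₖ₊₁     ≡⟨ sym (*-distribˡ-+ 2 bₖ sₖ₊₁) ⟩
    2 * (bₖ + sₖ₊₁)       ≡⟨ cong (2 *_) (sym (count-ball-suc k)) ⟩
    2 * count (ball (suc k)) ∎
    where
    open ≤-Reasoning
    bₖ sₖ₊₁ : ℕ
    bₖ = count (ball k)
    sₖ₊₁ = count (sphere (suc k))
    n+2≤2bₖ+2sₖ₊₁ : bₖ ≡ n ⊎ 1 ≤ sₖ₊₁ → n + 2 ≤ 2 * bₖ + 2 * sₖ₊₁
    n+2≤2bₖ+2sₖ₊₁ (inj₁ bₖ≡n) = begin
      n + 2             ≤⟨ +-monoʳ-≤ n 2≤n ⟩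
      n + n             ≡⟨ cong (n +_) (sym (+-identityʳ n)) ⟩
      2 * n             ≡⟨ cong (2 *_) (sym bₖ≡n) ⟩
      2 * bₖ            ≤⟨ m≤m+n (2 * bₖ) (2 * sₖ₊₁) ⟩
      2 * bₖ + 2 * sₖ₊₁ ∎
    n+2≤2bₖ+2sₖ₊₁ (inj₂ 1≤sₖ₊₁) =
      +-mono-≤ (<⇒≤ (ball-more-than-half k 2R<ak²)) (*-monoʳ-≤ 2 1≤sₖ₊₁)

-- Closing a cycle

record SimplePath {n : ℕ} (E : Fin n → Fin n → Bool) (d : ℕ) (x y : Fin n) : Set where
  field
    vertex    : Fin (suc d) → Fin n
    injective : Injective _≡_ _≡_ vertex
    source    : vertex zero ≡ x
    target    : ∀ i → toℕ i ≡ d → vertex i ≡ y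
    step      : ∀ i j → toℕ j ≡ suc (toℕ i) → E (vertex i) (vertex j) ≡ true

open SimplePath

SimplePath-trivial : ∀ {n} {E : Fin n → Fin n → Bool} {x y : Fin n} → x ≡ y → SimplePath E 0 x y
SimplePath-trivial {x = x} x≡y = record
  { vertex    = λ _ → x
  ; injective = λ { {zero} {zero} _ → refl }
  ; source    = refl
  ; target    = λ _ _ → x≡y
  ; step      = λ { zero zero () }
  }

SimplePath-cons : ∀ {n} {E : Fin n → Fin n → Bool} {d x y z} → E x y ≡ true →
                  (P : SimplePath E d y z) → (∀ i → vertex P i ≢ x) → SimplePath E (suc d) x z
SimplePath-cons {n} {E} {d} {x} Exy P x∉P = record
  { vertex    = vertex′
  ; injective = injective′
  ; source    = refl
  ; target    = λ { (suc i) i≡d → target P i (suc-injective i≡d) }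
  ; step      = step′
  }
  where
  vertex′ : Fin (suc (suc d)) → Fin n
  vertex′ zero    = x
  vertex′ (suc i) = vertex P i

  injective′ : Injective _≡_ _≡_ vertex′
  injective′ {zero}  {zero}  _   = refl
  injective′ {zero}  {suc j} x≡P = contradiction (sym x≡P) (x∉P j)
  injective′ {suc i} {zero}  P≡x = contradiction P≡x (x∉P i)
  injective′ {suc i} {suc j} P≡P = cong suc (injective P P≡P)

  step′ : ∀ i j → toℕ j ≡ suc (toℕ i) → E (vertex′ i) (vertex′ j) ≡ true
  step′ zero    (suc zero) _    = subst (λ u → E x u ≡ true) (sym (source P)) Exy
  step′ (suc i) (suc j)    j≡i+1 = step P i j (suc-injective j≡i+1)

module _ {n : ℕ} (E : Fin n → Fin n → Bool) (v : Fin n) where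
  private
    module Out = Ball E v
    module In = Ball (flip E) v

  -- Induction along a walk from v to w, moving back one vertex at a time.
  returning-out-neighbour : ∀ a j {w} → Out.ball (suc a) w ≡ true → In.ball j w ≡ true → w ≢ v →
                            ∃ λ y → E v y ≡ true × In.ball (a + j) y ≡ true
  returning-out-neighbour zero j {w} w∈Out₁ w∈Inⱼ w≢v with Out.ball-suc⁻ 0 w∈Out₁
  ... | inj₁ w∈Out₀ = contradiction (Out.ball-zero⁻ w∈Out₀) w≢v
  ... | inj₂ (x , x∈Out₀ , Exw) =
    w , subst (λ u → E u w ≡ true) (Out.ball-zero⁻ x∈Out₀) Exw , w∈Inⱼ
  returning-out-neighbour (suc a) j {w} w∈Outₐ₊₂ w∈Inⱼ w≢v with Out.ball-suc⁻ (suc a) w∈Outₐ₊₂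
  ... | inj₁ w∈Outₐ₊₁ =
    let y , Evy , y∈In = returning-out-neighbour a j w∈Outₐ₊₁ w∈Inⱼ w≢v
    in y , Evy , In.ball-mono (n≤1+n (a + j)) y∈In
  ... | inj₂ (x , x∈Outₐ₊₁ , Exw) with x ≟ v
  ...   | yes x≡v =
    w , subst (λ u → E u w ≡ true) x≡v Exw , In.ball-mono (m≤n+m j (suc a)) w∈Inⱼ
  ...   | no  x≢v =
    let y , Evy , y∈In =
          returning-out-neighbour a (suc j) x∈Outₐ₊₁ (In.ball-step j w∈Inⱼ Exw) x≢v
    in y , Evy , subst (λ k → In.ball k y ≡ true) (+-suc a j) y∈In

  -- The path is simple because after its first vertex y it stays in the ball of radius d - 1,
  -- which does not contain y.
  geodesic : ∀ d {y} → In.sphere d y ≡ true →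
             Σ (SimplePath E d y v) λ P → ∀ i → In.ball d (vertex P i) ≡ true
  geodesic zero    y∈S₀ = SimplePath-trivial (In.ball-zero⁻ y∈S₀) , λ _ → y∈S₀
  geodesic (suc d) {y} y∈Sd₊₁ =
    let z , z∈Sd , Eyz = In.sphere-pred d y∈Sd₊₁
        P , P⊆Bd = geodesic d z∈Sd
        y∉P : ∀ i → vertex P i ≢ y
        y∉P i Pᵢ≡y = case trans (sym (subst (λ u → In.ball d u ≡ true) Pᵢ≡y (P⊆Bd i)))
                                (In.sphere-suc⁻ d y∈Sd₊₁) of λ ()
    in SimplePath-cons Eyz P y∉P ,
       λ { zero → In.sphere⇒ball (suc d) y∈Sd₊₁ ; (suc i) → In.ball-suc⁺ d (P⊆Bd i) }

SimplePath⇒DirectedCycle : ∀ {n} (G : Digraph n) {d x y} → 1 ≤ d →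
  SimplePath (edge G) d x y → edge G y x ≡ true → DirectedCycle G (suc d)
SimplePath⇒DirectedCycle G {x = x} {y} 1≤d P Eyx = record
  { len≥2    = s≤s 1≤d
  ; vert     = vertex P
  ; distinct = injective P
  ; step     = step P
  ; close    = λ { i zero i+1≡d+1 _ → subst₂ (λ a b → edge G a b ≡ true)
                     (sym (target P i (suc-injective i+1≡d+1))) (sym (source P)) Eyx }
  }

cycle-through : ∀ {n} (G : Digraph n) {v y : Fin n} D → edge G v y ≡ true →
                Ball.ball (flip (edge G)) v D y ≡ true → OnShortCycle G (suc D) v
cycle-through G {v} D Evy y∈In with Ball.ball⇒sphere (flip (edge G)) v D y∈In
... | zero , _ , y∈S₀ =
  case trans (sym (subst (λ u → edge G v u ≡ true) (Ball.ball-zero⁻ (flip (edge G)) v y∈S₀) Evy))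
             (loopless G v) of λ ()
... | suc d , d+1≤D , y∈Sd₊₁ =
  let P = proj₁ (geodesic (edge G) v (suc d) y∈Sd₊₁)
  in suc (suc d) , s≤s d+1≤D , SimplePath⇒DirectedCycle G (s≤s z≤n) P Evy ,
     fromℕ (suc d) , target P (fromℕ (suc d)) (toℕ-fromℕ (suc d))

OnShortCycle-mono : ∀ {n} {G : Digraph n} {r r′ v} → r ≤ r′ →
                    OnShortCycle G r v → OnShortCycle G r′ v
OnShortCycle-mono r≤r′ (ℓ , ℓ≤r , C) = ℓ , ≤-trans ℓ≤r r≤r′ , C

halve : ∀ r → ∃ λ m → 2 * m ≤ r × r ≤ 1 + 2 * m
halve zero          = 0 , z≤n , z≤n
halve (suc zero)    = 0 , z≤n , s≤s z≤n
halve (suc (suc r)) = let m , 2m≤r , r≤1+2m = halve r in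
  suc m , subst (_≤ 2 + r) (sym (*-suc 2 m)) (s≤s (s≤s 2m≤r)) ,
          subst (2 + r ≤_) (cong suc (sym (*-suc 2 m))) (s≤s (s≤s r≤1+2m))

radius-bounds : ∀ r t → 2 * (4 + t) ≤ r → r ≤ 1 + 2 * (4 + t) →
                suc (3 + t + suc (3 + t)) ≤ r × 2 * (r * r) < 25 * ((3 + t) * (3 + t))
radius-bounds r t 2m≤r r≤1+2m = subst (_≤ r) (e₁ t) 2m≤r , (begin-strict
  2 * (r * r)                                  ≤⟨ *-monoʳ-≤ 2 (*-mono-≤ r≤9+2t r≤9+2t) ⟩
  2 * ((9 + 2 * t) * (9 + 2 * t))              <⟨ m<m+n _ {suc (17 * (t * t) + 78 * t + 62)} (s≤s z≤n) ⟩
  2 * ((9 + 2 * t) * (9 + 2 * t)) + suc (17 * (t * t) + 78 * t + 62) ≡⟨ e₃ t ⟩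
  25 * ((3 + t) * (3 + t))                     ∎)
  where
  open ≤-Reasoning
  e₁ : ∀ t → 2 * (4 + t) ≡ suc (3 + t + suc (3 + t))
  e₁ = solve-∀
  e₂ : ∀ t → 1 + 2 * (4 + t) ≡ 9 + 2 * t
  e₂ = solve-∀
  e₃ : ∀ t → 2 * ((9 + 2 * t) * (9 + 2 * t)) + suc (17 * (t * t) + 78 * t + 62) ≡
             25 * ((3 + t) * (3 + t))
  e₃ = solve-∀
  r≤9+2t : r ≤ 9 + 2 * t
  r≤9+2t = ≤-trans r≤1+2m (≤-reflexive (e₂ t))

-- k = ⌊r/2⌋ - 1
radius : ∀ {r} → 9 ≤ r → ∃ λ k → suc (k + suc k) ≤ r × 2 * (r * r) < 25 * (k * k)
radius {r} 9≤r with halve r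
... | m , 2m≤r , r≤1+2m
    with m≤n⇒∃[o]m+o≡n (*-cancelˡ-≤ {4} {m} 2 (≤-pred (≤-trans 9≤r r≤1+2m)))
... | t , refl = 3 + t , radius-bounds r t 2m≤r r≤1+2m

m≤2n⇒m≤2o⇒m≤n+o : ∀ {m n o} → m ≤ 2 * n → m ≤ 2 * o → m ≤ n + o
m≤2n⇒m≤2o⇒m≤n+o {m} {n} {o} m≤2n m≤2o = *-cancelˡ-≤ 2 (begin
  2 * m         ≡⟨ cong (m +_) (+-identityʳ m) ⟩
  m + m         ≤⟨ +-mono-≤ m≤2n m≤2o ⟩
  2 * n + 2 * o ≡⟨ sym (*-distribˡ-+ 2 n o) ⟩
  2 * (n + o)   ∎)
  where open ≤-Reasoning

theorem1p2 : (n : ℕ) (G : Digraph n) (r : ℕ) → 9 ≤ r → 2 ≤ n →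
    μG≥ G (25 * n) (r * r) → (v : Fin n) → OnShortCycle G r v
theorem1p2 n G r 9≤r 2≤n μ≥ v =
  let k , 2k+2≤r , 2r²<25k² = radius 9≤r
      Out = Ball.ball (edge G) v (suc k)
      In = Ball.ball (flip (edge G)) v (suc k)
      out = μG≥⇒Expanding G (25 * n) (r * r) μ≥
      large-Out = ExpandingBall.ball-beyond-half {a = 25} out v (s≤s z≤n) 2≤n k 2r²<25k²
      large-In  = ExpandingBall.ball-beyond-half {a = 25} (Expanding-flip out) v
                    (s≤s z≤n) 2≤n k 2r²<25k²
      w , w∈Out , w∈In , w≢v = common-element Out In v
        (m≤2n⇒m≤2o⇒m≤n+o {n = count Out} {count In} large-Out large-In)
      y , Evy , y∈In = returning-out-neighbour (edge G) v k (suc k) w∈Out w∈In w≢v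
  in OnShortCycle-mono 2k+2≤r (cycle-through G (k + suc k) Evy y∈In)
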